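{- Let $\mathbb{M}=(\mathbb{K},v)$ be a named model based on a finite context $\mathbb{K}=(G,M,I)$, and let $(A,B)$ be a concept of $\mathbb{K}$. Then there is a formula $\alpha$ of $\mathbf{PDBL}$ such that $v(\alpha)=(A,B)$.
   Context: Formulae of PDBL are built from object variables $\mathbf{OV}$ and property variables $\mathbf{PV}$ (disjoint countably infinite sets) and constants $\top,\bot$ by the binary connectives $\sqcap,\sqcup$ and unary connectives $\neg,\lrcorner$. A context is $\mathbb{K}=(G,M,I)$ with $I\subseteq G\times M$; for $A\subseteq G$, $A'=\{m\in M:gIm\ \forall g\in A\}$, for $B\subseteq M$, $B'=\{g\in G:gIm\ \forall m\in B\}$. A concept is a pair $(A,B)$ with $A'=B$ and $B'=A$; a semiconcept is a pair with $A'=B$ or $B'=A$. The set $\mathfrak{H}(\mathbb{K})$ of semiconcepts carries the operations $(A_1,B_1)\sqcap(A_2,B_2)=(A_1\cap A_2,(A_1\cap A_2)')$, $(A_1,B_1)\sqcup(A_2,B_2)=((B_1\cap B_2)',B_1\cap B_2)$, $\neg(A,B)=(G\setminus A,(G\setminus A)')$, $\lrcorner(A,B)=((M\setminus B)',M\setminus B)$, $\top=(G,\emptyset)$, $\bot=(\emptyset,M)$. A model is $\mathbb{M}=(\mathbb{K},v)$ where $v$ maps $\mathbf{OV}\cup\mathbf{PV}\cup\{\top,\bot\}$ into $\mathfrak{H}(\mathbb{K})$ with $v(p)\sqcap v(p)=v(p)$ for $p\in\mathbf{OV}$, $v(P)\sqcup v(P)=v(P)$ for $P\in\mathbf{PV}$,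 $v(\top)=(G,\emptyset)$, $v(\bot)=(\emptyset,M)$; $v$ is extended to all formulae homomorphically ($v(\alpha\sqcap\beta)=v(\alpha)\sqcap v(\beta)$, $v(\alpha\sqcup\beta)=v(\alpha)\sqcup v(\beta)$, $v(\neg\alpha)=\neg v(\alpha)$, $v(\lrcorner\alpha)=\lrcorner v(\alpha)$). A named model is a model such that: for each $p\in\mathbf{OV}$, $v(p)=(\{g\},\{g\}')$ for some $g\in G$; for each $P\in\mathbf{PV}$, $v(P)=(\{m\}',\{m\})$ for some $m\in M$; for each $g\in G$ there is $p\in\mathbf{OV}$ with $v(p)=(\{g\},\{g\}')$; and for each $m\in M$ there is $P\in\mathbf{PV}$ with $v(P)=(\{m\}',\{m\})$. -}

module Defs where

open import Data.Nat using (ℕ; suc)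
open import Data.Bool using (Bool; true; false; _∧_; not; _∨_)
open import Data.Fin using (Fin; zero; suc)
open import Data.Vec using (Vec; tabulate; lookup)
open import Data.Fin.Subset as S using (Subset; ⁅_⁆; ∁; _∩_)
open import Data.Product using (_×_; _,_; Σ; ∃)
open import Data.Sum using (_⊎_)
open import Relation.Binary.PropositionalEquality using (_≡_)

record Context : Set where
  field
    nG : ℕ
    nM : ℕ
    I  : Fin nG → Fin nM → Bool

allFin : ∀ {n} → (Fin n → Bool) → Bool
allFin {ℕ.zero} f = true
allFin {suc n} f = f zero ∧ allFin (λ i → f (suc i))

module _ (K : Context) where
  open Context K

  Ext : Set
  Ext = Subset nG

  Int : Set
  Int = Subset nM

  _′ᴳ : Ext → Int
  A ′ᴳ = tabulate λ j → allFin λ i → not (lookup A i) ∨ I i j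

  _′ᴹ : Int → Ext
  B ′ᴹ = tabulate λ i → allFin λ j → not (lookup B j) ∨ I i j

  Pair : Set
  Pair = Ext × Int

  IsConcept : Ext → Int → Set
  IsConcept A B = (A ′ᴳ ≡ B) × (B ′ᴹ ≡ A)

  IsSemiconcept : Pair → Set
  IsSemiconcept (A , B) = (A ′ᴳ ≡ B) ⊎ (B ′ᴹ ≡ A)

  _⊓_ : Pair → Pair → Pair
  (A₁ , B₁) ⊓ (A₂ , B₂) = (A₁ ∩ A₂) , ((A₁ ∩ A₂) ′ᴳ)

  _⊔_ : Pair → Pair → Pair
  (A₁ , B₁) ⊔ (A₂ , B₂) = ((B₁ ∩ B₂) ′ᴹ) , (B₁ ∩ B₂)

  neg : Pair → Pair
  neg (A , B) = ∁ A , (∁ A) ′ᴳ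

  corner : Pair → Pair
  corner (A , B) = (∁ B) ′ᴹ , ∁ B

  top : Pair
  top = S.⊤ , S.⊥

  bot : Pair
  bot = S.⊥ , S.⊤

-- Formulae of PDBL; object variables OV and property variables PV are
-- both indexed by ℕ (disjoint countably infinite sets).
data Formula : Set where
  ov   : ℕ → Formula
  pv   : ℕ → Formula
  ⊤f   : Formula
  ⊥f   : Formula
  _⊓f_ : Formula → Formula → Formula
  _⊔f_ : Formula → Formula → Formula
  ¬f   : Formula → Formula
  ⌟f   : Formula → Formula

record Model (K : Context) : Set where
  field
    vO : ℕ → Pair K
    vP : ℕ → Pair K
    vO-semi : ∀ p → IsSemiconcept K (vO p)
    vP-semi : ∀ P → IsSemiconcept K (vP P)
    vO-idem : ∀ p → _⊓_ K (vO p) (vO p) ≡ vO p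
    vP-idem : ∀ P → _⊔_ K (vP P) (vP P) ≡ vP P

eval : ∀ {K} → Model K → Formula → Pair K
eval 𝕄 (ov p) = Model.vO 𝕄 p
eval 𝕄 (pv P) = Model.vP 𝕄 P
eval {K} 𝕄 ⊤f = top K
eval {K} 𝕄 ⊥f = bot K
eval {K} 𝕄 (α ⊓f β) = _⊓_ K (eval 𝕄 α) (eval 𝕄 β)
eval {K} 𝕄 (α ⊔f β) = _⊔_ K (eval 𝕄 α) (eval 𝕄 β)
eval {K} 𝕄 (¬f α) = neg K (eval 𝕄 α)
eval {K} 𝕄 (⌟f α) = corner K (eval 𝕄 α)

record IsNamed {K : Context} (𝕄 : Model K) : Set where
  open Context K
  open Model 𝕄
  field
    ov-named : ∀ p → Σ (Fin nG) λ g → vO p ≡ (⁅ g ⁆ , _′ᴳ K ⁅ g ⁆)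
    pv-named : ∀ P → Σ (Fin nM) λ m → vP P ≡ (_′ᴹ K ⁅ m ⁆ , ⁅ m ⁆)
    ov-surj  : ∀ (g : Fin nG) → Σ ℕ λ p → vO p ≡ (⁅ g ⁆ , _′ᴳ K ⁅ g ⁆)
    pv-surj  : ∀ (m : Fin nM) → Σ ℕ λ P → vP P ≡ (_′ᴹ K ⁅ m ⁆ , ⁅ m ⁆)

{-# OPTIONS --safe #-}
module Submission where

-- A finite concept (A, B) is determined by its intent: A = B′ = ⋂_{m ∈ B} {m}′.
-- In a named model each {m}′ is the extent of a property variable, so the
-- conjunction of these variables has extent A; meeting it with ⊤ replaces its
-- intent by A′ = B.

open import Defs
open import Data.Bool using (Bool; true; false; _∧_; not; _∨_; if_then_else_)
open import Data.Bool.Properties using (∧-identityʳ)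
open import Data.Fin using (Fin; zero; suc)
open import Data.Fin.Subset as S using (⁅_⁆)
open import Data.Fin.Subset.Properties using (∩-identityˡ)
open import Data.Nat using (ℕ; zero; suc)
open import Data.Product using (Σ; _,_; proj₁; proj₂)
open import Data.Vec using (lookup; tabulate)
open import Data.Vec.Properties
  using (lookup-zipWith; lookup-replicate; lookup∘tabulate; tabulate∘lookup; tabulate-cong)
open import Function using (_∘_)
open import Relation.Binary.PropositionalEquality
  using (_≡_; _≗_; refl; sym; trans; cong; cong₂; module ≡-Reasoning)

allFin-cong : ∀ {n} {f g : Fin n → Bool} → f ≗ g → allFin f ≡ allFin g
allFin-cong {zero}  f≗g = refl
allFin-cong {suc n} f≗g = cong₂ _∧_ (f≗g zero) (allFin-cong (f≗g ∘ suc))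

allFin-⊥ : ∀ {n} (h : Fin n → Bool) →
  allFin (λ j → not (lookup (S.⊥ {n}) j) ∨ h j) ≡ true
allFin-⊥ {zero}  h = refl
allFin-⊥ {suc n} h = allFin-⊥ (h ∘ suc)

allFin-⁅⁆ : ∀ {n} (m : Fin n) (h : Fin n → Bool) →
  allFin (λ j → not (lookup ⁅ m ⁆ j) ∨ h j) ≡ h m
allFin-⁅⁆ zero    h = trans (cong (h zero ∧_) (allFin-⊥ (h ∘ suc))) (∧-identityʳ (h zero))
allFin-⁅⁆ (suc m) h = allFin-⁅⁆ m (h ∘ suc)

lookup-⁅⁆′ᴹ : (K : Context) (m : Fin (Context.nM K)) (g : Fin (Context.nG K)) →
  lookup (_′ᴹ K ⁅ m ⁆) g ≡ Context.I K g m
lookup-⁅⁆′ᴹ K m g = trans (lookup∘tabulate _ g) (allFin-⁅⁆ m (Context.I K g))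

⋀ : ∀ {k} → (Fin k → Formula) → Formula
⋀ {zero}  φ = ⊤f
⋀ {suc k} φ = φ zero ⊓f ⋀ (φ ∘ suc)

module _ {K : Context} (𝕄 : Model K) where

  extent : Formula → Ext K
  extent α = proj₁ (eval 𝕄 α)

  lookup-extent-⋀ : ∀ {k} (φ : Fin k → Formula) (g : Fin (Context.nG K)) →
    lookup (extent (⋀ φ)) g ≡ allFin (λ j → lookup (extent (φ j)) g)
  lookup-extent-⋀ {zero}  φ g = lookup-replicate g true
  lookup-extent-⋀ {suc k} φ g =
    trans (lookup-zipWith _∧_ g (extent (φ zero)) (extent (⋀ (φ ∘ suc))))
          (cong (lookup (extent (φ zero)) g ∧_) (lookup-extent-⋀ (φ ∘ suc) g))

  eval-⊤⊓ : (α : Formula) → eval 𝕄 (⊤f ⊓f α) ≡ (extent α , _′ᴳ K (extent α))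
  eval-⊤⊓ α = cong (λ X → X , _′ᴳ K X) (∩-identityˡ (extent α))

module _ {K : Context} {𝕄 : Model K} (named : IsNamed 𝕄) where
  open Context K
  open IsNamed named

  attributeVar : Fin nM → ℕ
  attributeVar m = proj₁ (pv-surj m)

  attributeLiteral : Int K → Fin nM → Formula
  attributeLiteral B m = if lookup B m then pv (attributeVar m) else ⊤f

  intentFormula : Int K → Formula
  intentFormula B = ⋀ (attributeLiteral B)

  lookup-extent-attributeLiteral : (B : Int K) (m : Fin nM) (g : Fin nG) →
    lookup (extent 𝕄 (attributeLiteral B m)) g ≡ not (lookup B m) ∨ I g m
  lookup-extent-attributeLiteral B m g with lookup B m
  ... | true  = trans (cong (λ v → lookup (proj₁ v) g) (proj₂ (pv-surj m))) (lookup-⁅⁆′ᴹ K m g)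
  ... | false = lookup-replicate g true

  extent-intentFormula : (B : Int K) → extent 𝕄 (intentFormula B) ≡ _′ᴹ K B
  extent-intentFormula B = trans (sym (tabulate∘lookup _)) (tabulate-cong λ g →
    trans (lookup-extent-⋀ 𝕄 (attributeLiteral B) g)
          (allFin-cong λ m → lookup-extent-attributeLiteral B m g))

proposition91 : (K : Context) (𝕄 : Model K) → IsNamed 𝕄 →
    (A : Ext K) (B : Int K) → IsConcept K A B →
    Σ Formula λ α → eval 𝕄 α ≡ (A , B)
proposition91 K 𝕄 named A B (A′≡B , B′≡A) = ⊤f ⊓f intentFormula named B , (begin
    eval 𝕄 (⊤f ⊓f intentFormula named B)  ≡⟨ eval-⊤⊓ 𝕄 (intentFormula named B) ⟩
    (X , _′ᴳ K X)                          ≡⟨ cong (λ Y → Y , _′ᴳ K Y) X≡A ⟩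
    (A , _′ᴳ K A)                          ≡⟨ cong (A ,_) A′≡B ⟩
    (A , B)                                ∎)
  where
  open ≡-Reasoning
  X : Ext K
  X = extent 𝕄 (intentFormula named B)
  X≡A : X ≡ A
  X≡A = trans (extent-intentFormula named B) B′≡A
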